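{- Let $G$ be a prereduced graph and $H$ a shortest hole of $G$. If $v$ is a vertex of $G$ that is not adjacent to every vertex of $H$, then $|N[v]\cap H|\le 3$.
   Context: Graphs are finite, simple, undirected. A hole is an induced cycle of length at least $4$, identified with its vertex set. A minimal forbidden set is $X\subseteq V(G)$ with $G[X]$ not an interval graph but every proper subset inducing an interval graph; $G$ is prereduced if it has no minimal forbidden set of at most $10$ vertices. -}

module Defs where

open import Data.Nat using (ℕ; zero; suc; _≤_)
open import Data.Bool using (Bool; true; false; _∨_; _∧_)
open import Data.Fin using (Fin; toℕ; _≟_)
open import Data.Fin.Subset using (Subset; _∈_; _⊂_; _∩_; ∣_∣)
open import Data.Fin.Properties using (any?)
open import Data.Vec using (tabulate)
open import Data.Product using (Σ; _×_; proj₁; proj₂)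
open import Data.Sum using (_⊎_)
open import Function.Bundles using (_⇔_)
open import Function.Definitions using (Injective)
open import Relation.Binary.PropositionalEquality using (_≡_; _≢_)
open import Relation.Nullary using (¬_; does)

record Graph (n : ℕ) : Set where
  field
    adj       : Fin n → Fin n → Bool
    adj-sym   : ∀ u v → adj u v ≡ adj v u
    adj-irref : ∀ v → adj v v ≡ false
open Graph public

-- Closed intervals [l , r] with natural-number endpoints (l ≤ r).
Interval : Set
Interval = ℕ × ℕ

Overlap : Interval → Interval → Set
Overlap I J = (proj₁ I ≤ proj₂ J) × (proj₁ J ≤ proj₂ I)

IsIntervalOn : ∀ {n} → Graph n → Subset n → Set
IsIntervalOn {n} G X =
  Σ (Fin n → Interval) λ I →
    (∀ u → u ∈ X → proj₁ (I u) ≤ proj₂ (I u)) ×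
    (∀ u w → u ∈ X → w ∈ X → u ≢ w →
       (adj G u w ≡ true) ⇔ Overlap (I u) (I w))

MinimalForbidden : ∀ {n} → Graph n → Subset n → Set
MinimalForbidden G X =
  ¬ IsIntervalOn G X × (∀ Y → Y ⊂ X → IsIntervalOn G Y)

Prereduced : ∀ {n} → Graph n → Set
Prereduced G = ∀ X → MinimalForbidden G X → ¬ (∣ X ∣ ≤ 10)

CycSucc : (k : ℕ) → Fin k → Fin k → Set
CycSucc k i j = (suc (toℕ i) ≡ toℕ j) ⊎ ((suc (toℕ i) ≡ k) × (toℕ j ≡ 0))

CycAdj : (k : ℕ) → Fin k → Fin k → Set
CycAdj k i j = CycSucc k i j ⊎ CycSucc k j i

record Hole {n : ℕ} (G : Graph n) : Set where
  field
    len      : ℕ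
    len≥4    : 4 ≤ len
    vert     : Fin len → Fin n
    vert-inj : Injective _≡_ _≡_ vert
    induced  : ∀ i j → (adj G (vert i) (vert j) ≡ true) ⇔ CycAdj len i j
open Hole public

holeSet : ∀ {n} {G : Graph n} → Hole G → Subset n
holeSet H = tabulate λ w → does (any? λ i → vert H i ≟ w)

ShortestHole : ∀ {n} (G : Graph n) → Hole G → Set
ShortestHole G H = ∀ (H' : Hole G) → len H ≤ len H'

closedNbhd : ∀ {n} → Graph n → Fin n → Subset n
closedNbhd G v = tabulate λ w → does (w ≟ v) ∨ adj G v w

-- If v lies on H, its neighbours on H are its two neighbours along the cycle.
-- Otherwise, unless v sees no vertex of H (and the bound is trivial) or all of
-- them (excluded), some h_i is adjacent to v while h_(i+1) is not. The next
-- neighbour h_j of v after h_i closes, with v, the hole v h_i h_(i+1) … h_j of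
-- length (j − i) + 2; as H is a shortest hole, j − i ≥ len H − 2, so every
-- neighbour of v on H is one of h_i, h_(i−1), h_(i−2).
module Submission where

open import Defs
open import Data.Bool using (Bool; true; false)
open import Data.Bool.Properties using (¬-not) renaming (_≟_ to _≟ᵇ_)
open import Data.Empty using (⊥-elim)
open import Data.Fin using (Fin; zero; suc; toℕ; fromℕ; fromℕ<; inject₁; inject≤; lower₁; _≟_)
open import Data.Fin.Induction using (<-wellFounded; <-weakInduction; <-weakInduction-startingFrom)
open import Data.Fin.Properties
  using (toℕ-injective; toℕ<n; toℕ-fromℕ; toℕ-fromℕ<; toℕ-inject₁; toℕ-inject≤; toℕ-lower₁; ≤fromℕ; any?)
open import Data.Fin.Subset using (Subset; _∈_; _∩_; _∪_; ∣_∣; ⁅_⁆; inside; outside)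
open import Data.Fin.Subset.Properties using (x∈p∩q⁻; x∈p∪q⁺; p⊆q⇒∣p∣≤∣q∣; x∈⁅y⁆⇔x≡y; ∣⁅x⁆∣≡1)
open import Data.Nat as ℕ using (ℕ; zero; suc; _+_; _≤_; _<_; z≤n; s≤s; s≤s⁻¹; _<?_)
open import Data.Nat.GeneralisedArithmetic using (fold)
open import Data.Nat.Properties
  using (<-irrefl; <-trans; ≤-trans; ≤-<-trans; <⇒≤; <⇒≱; ≮⇒≥; ≤∧≢⇒<; ≤-antisym; ≤-reflexive; n≢0⇒n>0; n<1+n;
         +-monoʳ-<; +-monoʳ-≤; +-suc; n≤1+n; suc-injective; 1+n≢0; module ≤-Reasoning)
open import Data.Product using (∃; _×_; _,_)
open import Data.Sum using (_⊎_; inj₁; inj₂; [_,_]; swap)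
import Data.Sum as Sum
open import Data.Sum.Function.Propositional using (_⊎-⇔_)
open import Data.Vec using ([]; _∷_; tabulate)
import Data.Vec.Functional as Vector
open import Data.Vec.Properties using ([]=⇒lookup; lookup∘tabulate)
open import Function using (_∘_)
open import Function.Bundles using (_⇔_; mk⇔; Equivalence)
open import Function.Definitions using (Injective)
import Function.Properties.Equivalence as ⇔
open import Induction.WellFounded using (module All)
open import Relation.Binary.PropositionalEquality using (_≡_; _≢_; refl; sym; trans; cong; cong₂; subst)
open import Relation.Nullary using (¬_; yes; no; contradiction)
open import Relation.Nullary.Decidable using (_×-dec_)

private variable
  k m n : ℕ

-- The cyclic structure of Fin k

sucᶜ : Fin k → Fin k
sucᶜ {suc m} i with m ℕ.≟ toℕ i
... | yes _   = zero
... | no m≢i = suc (lower₁ i m≢i)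

predᶜ : Fin k → Fin k
predᶜ zero    = fromℕ _
predᶜ (suc i) = inject₁ i

cycSucc-sucᶜ : (i : Fin k) → CycSucc k i (sucᶜ i)
cycSucc-sucᶜ {suc m} i with m ℕ.≟ toℕ i
... | yes m≡i = inj₂ (cong suc (sym m≡i) , refl)
... | no m≢i = inj₁ (cong suc (sym (toℕ-lower₁ i m≢i)))

cycSucc-predᶜ : (i : Fin k) → CycSucc k (predᶜ i) i
cycSucc-predᶜ {suc m} zero = inj₂ (cong suc (toℕ-fromℕ m) , refl)
cycSucc-predᶜ (suc i)      = inj₁ (cong suc (toℕ-inject₁ i))

cycSucc-functional : ∀ {i j j′ : Fin k} → CycSucc k i j → CycSucc k i j′ → j ≡ j′
cycSucc-functional      (inj₁ e)       (inj₁ e′)       = toℕ-injective (trans (sym e) e′)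
cycSucc-functional {j = j} (inj₁ e)    (inj₂ (e′ , _)) = contradiction (toℕ<n j) (<-irrefl (trans (sym e) e′))
cycSucc-functional {j′ = j′} (inj₂ (e , _)) (inj₁ e′)  = contradiction (toℕ<n j′) (<-irrefl (trans (sym e′) e))
cycSucc-functional      (inj₂ (_ , z)) (inj₂ (_ , z′)) = toℕ-injective (trans z (sym z′))

cycSucc-injective : ∀ {i i′ j : Fin k} → CycSucc k i j → CycSucc k i′ j → i ≡ i′
cycSucc-injective (inj₁ e)       (inj₁ e′)       = toℕ-injective (suc-injective (trans e (sym e′)))
cycSucc-injective (inj₁ e)       (inj₂ (_ , z))  = contradiction (trans e z) 1+n≢0
cycSucc-injective (inj₂ (_ , z)) (inj₁ e′)       = contradiction (trans e′ z) 1+n≢0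
cycSucc-injective (inj₂ (e , _)) (inj₂ (e′ , _)) = toℕ-injective (suc-injective (trans e (sym e′)))

sucᶜ-unique : ∀ {i j : Fin k} → CycSucc k i j → sucᶜ i ≡ j
sucᶜ-unique = cycSucc-functional (cycSucc-sucᶜ _)

sucᶜ-injective : Injective _≡_ _≡_ (sucᶜ {k})
sucᶜ-injective {x = i} {y = j} e = cycSucc-injective (cycSucc-sucᶜ i) (subst (CycSucc _ j) (sym e) (cycSucc-sucᶜ j))

sucᶜ-predᶜ : (i : Fin k) → sucᶜ (predᶜ i) ≡ i
sucᶜ-predᶜ i = sucᶜ-unique (cycSucc-predᶜ i)

sucᶜ≡⇒≡predᶜ : ∀ {i j : Fin k} → sucᶜ j ≡ i → j ≡ predᶜ i
sucᶜ≡⇒≡predᶜ {i = i} e = sucᶜ-injective (trans e (sym (sucᶜ-predᶜ i)))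

toℕ-sucᶜ : (i : Fin k) → suc (toℕ i) < k → toℕ (sucᶜ i) ≡ suc (toℕ i)
toℕ-sucᶜ i i⁺<k with cycSucc-sucᶜ i
... | inj₁ e       = sym e
... | inj₂ (e , _) = contradiction i⁺<k (<-irrefl e)

sucᶜ-wraps-within-two : (o i : Fin k) → toℕ o ≡ 0 → k ≤ 2 + toℕ i → sucᶜ i ≡ o ⊎ sucᶜ (sucᶜ i) ≡ o
sucᶜ-wraps-within-two {k} o i o≡0 k≤i⁺⁺ with suc (toℕ i) ℕ.≟ k
... | yes i⁺≡k = inj₁ (sucᶜ-unique (inj₂ (i⁺≡k , o≡0)))
... | no i⁺≢k  = inj₂ (sucᶜ-unique (inj₂ (i⁺⁺≡k , o≡0)))
  where
  i⁺<k : suc (toℕ i) < k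
  i⁺<k = ≤∧≢⇒< (toℕ<n i) i⁺≢k
  i⁺⁺≡k : suc (toℕ (sucᶜ i)) ≡ k
  i⁺⁺≡k = trans (cong suc (toℕ-sucᶜ i i⁺<k)) (≤-antisym i⁺<k k≤i⁺⁺)

cyclic-induction : ∀ {ℓ} (P : Fin k → Set ℓ) → (∀ i → P i → P (sucᶜ i)) → ∀ {i} → P i → ∀ j → P j
cyclic-induction {suc m} P step {i} Pi = <-weakInduction P P₀ step′
  where
  -- Climb from i up to the last element, wrap around to zero and climb again.
  step′ : ∀ j → P (inject₁ j) → P (suc j)
  step′ j = subst P (sucᶜ-predᶜ (suc j)) ∘ step (inject₁ j)
  P₀ : P zero
  P₀ = subst P (sucᶜ-predᶜ zero) (step _ (<-weakInduction-startingFrom P Pi step′ (≤fromℕ i)))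

cyclic-descent : (Q : Fin k → Bool) → ∃ (λ i → Q i ≡ true) → ¬ (∀ i → Q i ≡ true) →
                 ∃ λ i → Q i ≡ true × Q (sucᶜ i) ≡ false
cyclic-descent Q (i , Qi) not-all with any? (λ i → (Q i ≟ᵇ true) ×-dec (Q (sucᶜ i) ≟ᵇ false))
... | yes descent    = descent
... | no no-descent = contradiction (cyclic-induction (λ i → Q i ≡ true) step Qi) not-all
  where
  step : ∀ i → Q i ≡ true → Q (sucᶜ i) ≡ true
  step i Qi = ¬-not (λ Qi⁺ → no-descent (i , Qi , Qi⁺))

rotation-commutes : ∀ r (i : Fin k) → fold (sucᶜ i) sucᶜ r ≡ sucᶜ (fold i sucᶜ r)
rotation-commutes zero    i = refl
rotation-commutes (suc r) i = cong sucᶜ (rotation-commutes r i)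

rotation-injective : ∀ r → Injective _≡_ _≡_ (λ (i : Fin k) → fold i sucᶜ r)
rotation-injective zero    e = e
rotation-injective (suc r) e = rotation-injective r (sucᶜ-injective e)

rotation-surjective : ∀ r (j : Fin k) → ∃ λ i → fold i sucᶜ r ≡ j
rotation-surjective r j = cyclic-induction _ step {fold j sucᶜ r} (j , refl) j
  where
  step : ∀ j → ∃ (λ i → fold i sucᶜ r ≡ j) → ∃ λ i → fold i sucᶜ r ≡ sucᶜ j
  step _ (i , e) = sucᶜ i , trans (rotation-commutes r i) (cong sucᶜ e)

reachable : (o i : Fin k) → ∃ λ r → fold o sucᶜ r ≡ i
reachable o = cyclic-induction _ (λ _ (r , e) → suc r , cong sucᶜ e) (0 , refl)

module _ {σ : Fin k → Fin k} (σ-injective : Injective _≡_ _≡_ σ)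
         (σ-sucᶜ : ∀ i → σ (sucᶜ i) ≡ sucᶜ (σ i)) where

  cycSucc-invariant : ∀ i j → CycSucc k (σ i) (σ j) ⇔ CycSucc k i j
  cycSucc-invariant i j = mk⇔
    (λ c → subst (CycSucc k i) (σ-injective (trans (σ-sucᶜ i) (sucᶜ-unique c))) (cycSucc-sucᶜ i))
    (λ c → subst (CycSucc k (σ i)) (trans (sym (σ-sucᶜ i)) (cong σ (sucᶜ-unique c))) (cycSucc-sucᶜ (σ i)))

  cycAdj-invariant : ∀ i j → CycAdj k (σ i) (σ j) ⇔ CycAdj k i j
  cycAdj-invariant i j = cycSucc-invariant i j ⊎-⇔ cycSucc-invariant j i

module _ {G : Graph n} where

  rotate : Hole G → ℕ → Hole G
  rotate H r = record
    { len      = len H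
    ; len≥4    = len≥4 H
    ; vert     = λ i → vert H (fold i sucᶜ r)
    ; vert-inj = rotation-injective r ∘ vert-inj H
    ; induced  = λ i j → ⇔.trans (induced H _ _)
                                 (cycAdj-invariant (rotation-injective r) (rotation-commutes r) i j)
    }

  origin : (H : Hole G) → Fin (len H)
  origin H = fromℕ< (≤-trans (s≤s z≤n) (len≥4 H))

  hole-neighbours : (H : Hole G) (i j : Fin (len H)) →
                    adj G (vert H i) (vert H j) ≡ true → j ≡ sucᶜ i ⊎ j ≡ predᶜ i
  hole-neighbours H i j =
    Sum.map (sym ∘ sucᶜ-unique) (λ c → cycSucc-injective c (cycSucc-predᶜ i)) ∘ Equivalence.to (induced H i j)

-- Induced paths

Consecutive : Fin m → Fin m → Set
Consecutive i j = suc (toℕ i) ≡ toℕ j ⊎ suc (toℕ j) ≡ toℕ i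

record IsInducedPath (G : Graph n) (f : Fin m → Fin n) : Set where
  field
    injective       : Injective _≡_ _≡_ f
    adj⇔consecutive : ∀ i j → adj G (f i) (f j) ≡ true ⇔ Consecutive i j

cycAdj⇔consecutive : (i j : Fin k) → suc (toℕ i) < k → suc (toℕ j) < k → CycAdj k i j ⇔ Consecutive i j
cycAdj⇔consecutive i j i⁺<k j⁺<k = mk⇔ to (Sum.map inj₁ inj₁)
  where
  to : CycAdj _ i j → Consecutive i j
  to (inj₁ (inj₁ e))       = inj₁ e
  to (inj₁ (inj₂ (e , _))) = contradiction i⁺<k (<-irrefl e)
  to (inj₂ (inj₁ e))       = inj₂ e
  to (inj₂ (inj₂ (e , _))) = contradiction j⁺<k (<-irrefl e)

cycAdj-sym : ∀ {i j : Fin k} → CycAdj k i j ⇔ CycAdj k j i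
cycAdj-sym = mk⇔ swap swap

module _ {G : Graph n} where

  segment : (H : Hole G) → m < len H → Fin m → Fin n
  segment H m<k t = vert H (inject≤ t (<⇒≤ m<k))

  -- A run of fewer than len H consecutive vertices of a hole avoids the edge closing the cycle.
  segment-isInducedPath : (H : Hole G) (m<k : m < len H) → IsInducedPath G (segment H m<k)
  segment-isInducedPath H m<k = record
    { injective       = λ {s} {t} e → toℕ-injective
        (trans (sym (toℕ-inject≤ s _)) (trans (cong toℕ (vert-inj H e)) (toℕ-inject≤ t _)))
    ; adj⇔consecutive = λ s t → ⇔.trans (induced H (ι s) (ι t))
        (⇔.trans (cycAdj⇔consecutive (ι s) (ι t) (short s) (short t)) (consecutive-ι s t))
    }
    where
    ι : Fin _ → Fin (len H)
    ι t = inject≤ t (<⇒≤ m<k)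
    short : ∀ t → suc (toℕ (ι t)) < len H
    short t rewrite toℕ-inject≤ t (<⇒≤ m<k) = ≤-<-trans (toℕ<n t) m<k
    consecutive-ι : ∀ s t → Consecutive (ι s) (ι t) ⇔ Consecutive s t
    consecutive-ι s t rewrite toℕ-inject≤ s (<⇒≤ m<k) | toℕ-inject≤ t (<⇒≤ m<k) = ⇔.refl

  closeInducedPath : ∀ {B} {f : Fin (suc B) → Fin n} → IsInducedPath G f → 2 ≤ B →
                     (v : Fin n) → (∀ t → f t ≢ v) →
                     (∀ t → adj G v (f t) ≡ true ⇔ (toℕ t ≡ 0 ⊎ toℕ t ≡ B)) → Hole G
  closeInducedPath {B} {f} path 2≤B v v∉f v-ends = record
    { len      = suc (suc B)
    ; len≥4    = s≤s (s≤s 2≤B)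
    ; vert     = v Vector.∷ f
    ; vert-inj = injective′
    ; induced  = induced′
    }
    where
    open IsInducedPath path
    injective′ : Injective _≡_ _≡_ (v Vector.∷ f)
    injective′ {zero}  {zero}  _ = refl
    injective′ {zero}  {suc t} e = contradiction (sym e) (v∉f t)
    injective′ {suc s} {zero}  e = contradiction e (v∉f s)
    injective′ {suc s} {suc t} e = cong suc (injective e)

    apex : ∀ t → CycAdj (suc (suc B)) zero (suc t) ⇔ (toℕ t ≡ 0 ⊎ toℕ t ≡ B)
    apex t = mk⇔ to from
      where
      to : CycAdj _ zero (suc t) → toℕ t ≡ 0 ⊎ toℕ t ≡ B
      to (inj₁ (inj₁ e))        = inj₁ (sym (suc-injective e))
      to (inj₁ (inj₂ (_ , ())))
      to (inj₂ (inj₁ ()))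
      to (inj₂ (inj₂ (e , _)))  = inj₂ (suc-injective (suc-injective e))
      from : toℕ t ≡ 0 ⊎ toℕ t ≡ B → CycAdj _ zero (suc t)
      from (inj₁ e) = inj₁ (inj₁ (cong suc (sym e)))
      from (inj₂ e) = inj₂ (inj₂ (cong (λ b → suc (suc b)) e , refl))

    inner : ∀ s t → Consecutive s t ⇔ CycAdj (suc (suc B)) (suc s) (suc t)
    inner s t = mk⇔ (Sum.map (inj₁ ∘ cong suc) (inj₁ ∘ cong suc)) to
      where
      to : CycAdj _ (suc s) (suc t) → Consecutive s t
      to (inj₁ (inj₁ e))        = inj₁ (suc-injective e)
      to (inj₁ (inj₂ (_ , ())))
      to (inj₂ (inj₁ e))        = inj₂ (suc-injective e)
      to (inj₂ (inj₂ (_ , ())))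

    induced′ : ∀ s t → adj G ((v Vector.∷ f) s) ((v Vector.∷ f) t) ≡ true ⇔ CycAdj (suc (suc B)) s t
    induced′ zero    zero    = mk⇔ (λ e → contradiction (trans (sym e) (adj-irref G v)) λ ())
      λ { (inj₁ (inj₁ ())) ; (inj₁ (inj₂ (() , _))) ; (inj₂ (inj₁ ())) ; (inj₂ (inj₂ (() , _))) }
    induced′ zero    (suc t) = ⇔.trans (v-ends t) (⇔.sym (apex t))
    induced′ (suc s) zero rewrite adj-sym G (f s) v = ⇔.trans (induced′ zero (suc s)) cycAdj-sym
    induced′ (suc s) (suc t) = ⇔.trans (adj⇔consecutive s t) (inner s t)

-- Shortest holes

module _ {G : Graph n} (H : Hole G) {v : Fin n} (v∉H : ∀ i → vert H i ≢ v) where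

  gapHole : (o b : Fin (len H)) → toℕ o ≡ 0 → 2 ≤ toℕ b → suc (toℕ b) < len H →
            adj G v (vert H o) ≡ true → adj G v (vert H b) ≡ true →
            (∀ j → 0 < toℕ j → toℕ j < toℕ b → adj G v (vert H j) ≢ true) → Hole G
  gapHole o b o≡0 2≤b b⁺<k v~o v~b v≁between =
    closeInducedPath (segment-isInducedPath H b⁺<k) 2≤b v (v∉H ∘ ι) ends
    where
    ι : Fin (suc (toℕ b)) → Fin (len H)
    ι t = inject≤ t (<⇒≤ b⁺<k)
    toℕ-ι : ∀ t → toℕ (ι t) ≡ toℕ t
    toℕ-ι t = toℕ-inject≤ t (<⇒≤ b⁺<k)
    v~ι : ∀ {t x} → toℕ t ≡ toℕ x → adj G v (vert H x) ≡ true → adj G v (vert H (ι t)) ≡ true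
    v~ι {t} e = subst (λ y → adj G v (vert H y) ≡ true) (sym (toℕ-injective (trans (toℕ-ι t) e)))
    ends : ∀ t → adj G v (vert H (ι t)) ≡ true ⇔ (toℕ t ≡ 0 ⊎ toℕ t ≡ toℕ b)
    ends t = mk⇔ to [ (λ t≡0 → v~ι (trans t≡0 (sym o≡0)) v~o) , (λ t≡b → v~ι t≡b v~b) ]
      where
      to : adj G v (vert H (ι t)) ≡ true → toℕ t ≡ 0 ⊎ toℕ t ≡ toℕ b
      to v~t with toℕ t ℕ.≟ 0 | toℕ t ℕ.≟ toℕ b
      ... | yes t≡0 | _       = inj₁ t≡0
      ... | no _    | yes t≡b = inj₂ t≡b
      ... | no t≢0  | no t≢b  = contradiction v~t (v≁between (ι t)
              (subst (0 <_) (sym (toℕ-ι t)) (n≢0⇒n>0 t≢0))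
              (subst (_< toℕ b) (sym (toℕ-ι t)) (≤∧≢⇒< (s≤s⁻¹ (toℕ<n t)) t≢b)))

  module _ (shortest : ShortestHole G H) where

    -- By strong induction on j, the first neighbour h_j of v past h_o closes the
    -- hole v h_o … h_j of length j + 2, so j + 2 ≥ len H.
    neighbours-after-descent : (o : Fin (len H)) → toℕ o ≡ 0 →
      adj G v (vert H o) ≡ true → adj G v (vert H (sucᶜ o)) ≡ false →
      ∀ j → adj G v (vert H j) ≡ true → j ≡ o ⊎ sucᶜ j ≡ o ⊎ sucᶜ (sucᶜ j) ≡ o
    neighbours-after-descent o o≡0 v~o v≁o⁺ j v~j with toℕ j ℕ.≟ 0 | 2 + toℕ j <? len H
    ... | yes j≡0 | _         = inj₁ (toℕ-injective (trans j≡0 (sym o≡0)))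
    ... | no _    | no long   = inj₂ (sucᶜ-wraps-within-two o j o≡0 (≮⇒≥ long))
    ... | no j≢0  | yes short = contradiction v~j (no-short-neighbour j (n≢0⇒n>0 j≢0) short)
      where
      ShortNonNeighbour : Fin (len H) → Set
      ShortNonNeighbour j = 0 < toℕ j → 2 + toℕ j < len H → adj G v (vert H j) ≢ true

      toℕ-o⁺ : toℕ (sucᶜ o) ≡ 1
      toℕ-o⁺ = trans (toℕ-sucᶜ o (subst (λ x → suc x < len H) (sym o≡0) (≤-trans (s≤s (s≤s z≤n)) (len≥4 H))))
                     (cong suc o≡0)

      step : ∀ j → (∀ {i} → toℕ i < toℕ j → ShortNonNeighbour i) → ShortNonNeighbour j
      step j ih 0<j short v~j with toℕ j ℕ.≟ 1
      ... | yes j≡1 = contradiction (trans (sym v~j) (subst (λ y → adj G v (vert H y) ≡ false) o⁺≡j v≁o⁺)) λ ()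
        where
        o⁺≡j : sucᶜ o ≡ j
        o⁺≡j = toℕ-injective (trans toℕ-o⁺ (sym j≡1))
      ... | no j≢1  = <⇒≱ short (shortest (gapHole o j o≡0 (≤∧≢⇒< 0<j (j≢1 ∘ sym)) (<-trans (n<1+n _) short)
                                                    v~o v~j between))
        where
        between : ∀ i → 0 < toℕ i → toℕ i < toℕ j → adj G v (vert H i) ≢ true
        between i 0<i i<j = ih i<j 0<i (<-trans (+-monoʳ-< 2 i<j) short)

      no-short-neighbour : ∀ j → ShortNonNeighbour j
      no-short-neighbour = All.wfRec <-wellFounded _ ShortNonNeighbour step

neighbours-of-descent : {G : Graph n} (H : Hole G) → ShortestHole G H → ∀ {v} → (∀ i → vert H i ≢ v) →
  (i : Fin (len H)) → adj G v (vert H i) ≡ true → adj G v (vert H (sucᶜ i)) ≡ false →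
  ∀ j → adj G v (vert H j) ≡ true → j ≡ i ⊎ j ≡ predᶜ i ⊎ j ≡ predᶜ (predᶜ i)
neighbours-of-descent {G = G} H shortest {v} v∉H i v~i v≁i⁺ j v~j
  with reachable (origin H) i
... | r , refl with rotation-surjective r j
...   | x , refl = Sum.map (cong σ) (Sum.map (sucᶜ≡⇒≡predᶜ ∘ σ-sucᶜ≡) (sucᶜ≡⇒≡predᶜ ∘ sucᶜ≡⇒≡predᶜ ∘ σ-sucᶜ²≡))
      (neighbours-after-descent (rotate H r) (v∉H ∘ σ) shortest (origin H) (toℕ-fromℕ< _) v~i v≁o⁺ x v~j)
  where
  σ : Fin (len H) → Fin (len H)
  σ y = fold y sucᶜ r
  v≁o⁺ : adj G v (vert H (σ (sucᶜ (origin H)))) ≡ false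
  v≁o⁺ = subst (λ y → adj G v (vert H y) ≡ false) (sym (rotation-commutes r (origin H))) v≁i⁺
  σ-sucᶜ≡ : sucᶜ x ≡ origin H → sucᶜ (σ x) ≡ σ (origin H)
  σ-sucᶜ≡ e = trans (sym (rotation-commutes r x)) (cong σ e)
  σ-sucᶜ²≡ : sucᶜ (sucᶜ x) ≡ origin H → sucᶜ (sucᶜ (σ x)) ≡ σ (origin H)
  σ-sucᶜ²≡ e = trans (sym (trans (rotation-commutes r (sucᶜ x)) (cong sucᶜ (rotation-commutes r x)))) (cong σ e)

-- Counting

∣p∪q∣≤∣p∣+∣q∣ : (p q : Subset n) → ∣ p ∪ q ∣ ≤ ∣ p ∣ + ∣ q ∣
∣p∪q∣≤∣p∣+∣q∣ []            []            = z≤n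
∣p∪q∣≤∣p∣+∣q∣ (outside ∷ p) (outside ∷ q) = ∣p∪q∣≤∣p∣+∣q∣ p q
∣p∪q∣≤∣p∣+∣q∣ (outside ∷ p) (inside ∷ q)  = ≤-trans (s≤s (∣p∪q∣≤∣p∣+∣q∣ p q)) (≤-reflexive (sym (+-suc ∣ p ∣ ∣ q ∣)))
∣p∪q∣≤∣p∣+∣q∣ (inside ∷ p)  (outside ∷ q) = s≤s (∣p∪q∣≤∣p∣+∣q∣ p q)
∣p∪q∣≤∣p∣+∣q∣ (inside ∷ p)  (inside ∷ q)  = s≤s (≤-trans (∣p∪q∣≤∣p∣+∣q∣ p q) (+-monoʳ-≤ ∣ p ∣ (n≤1+n ∣ q ∣)))

p⊆⁅x,y,z⁆⇒∣p∣≤3 : (p : Subset n) (x y z : Fin n) →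
                  (∀ {w} → w ∈ p → w ≡ x ⊎ w ≡ y ⊎ w ≡ z) → ∣ p ∣ ≤ 3
p⊆⁅x,y,z⁆⇒∣p∣≤3 p x y z p⊆xyz = begin
  ∣ p ∣                               ≤⟨ p⊆q⇒∣p∣≤∣q∣ (x∈p∪q⁺ ∘ Sum.map ⁅⁆⁺ (x∈p∪q⁺ ∘ Sum.map ⁅⁆⁺ ⁅⁆⁺) ∘ p⊆xyz) ⟩
  ∣ ⁅ x ⁆ ∪ (⁅ y ⁆ ∪ ⁅ z ⁆) ∣         ≤⟨ ∣p∪q∣≤∣p∣+∣q∣ ⁅ x ⁆ _ ⟩
  ∣ ⁅ x ⁆ ∣ + ∣ ⁅ y ⁆ ∪ ⁅ z ⁆ ∣        ≤⟨ +-monoʳ-≤ ∣ ⁅ x ⁆ ∣ (∣p∪q∣≤∣p∣+∣q∣ ⁅ y ⁆ ⁅ z ⁆) ⟩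
  ∣ ⁅ x ⁆ ∣ + (∣ ⁅ y ⁆ ∣ + ∣ ⁅ z ⁆ ∣)  ≡⟨ cong₂ _+_ (∣⁅x⁆∣≡1 x) (cong₂ _+_ (∣⁅x⁆∣≡1 y) (∣⁅x⁆∣≡1 z)) ⟩
  3                                   ∎
  where
  open ≤-Reasoning
  ⁅⁆⁺ : ∀ {w u : Fin _} → w ≡ u → w ∈ ⁅ u ⁆
  ⁅⁆⁺ = Equivalence.from x∈⁅y⁆⇔x≡y

∈-tabulate⁻ : ∀ {f : Fin n → Bool} {w} → w ∈ tabulate f → f w ≡ true
∈-tabulate⁻ {f = f} {w} w∈ = trans (sym (lookup∘tabulate f w)) ([]=⇒lookup w∈)

module _ {G : Graph n} where

  ∈closedNbhd⁻ : ∀ {v w} → w ∈ closedNbhd G v → w ≡ v ⊎ adj G v w ≡ true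
  ∈closedNbhd⁻ {v} {w} w∈ with w ≟ v | ∈-tabulate⁻ w∈
  ... | yes w≡v | _   = inj₁ w≡v
  ... | no _    | v~w = inj₂ v~w

  ∈holeSet⁻ : ∀ {H : Hole G} {w} → w ∈ holeSet H → ∃ λ j → vert H j ≡ w
  ∈holeSet⁻ {H} {w} w∈ with any? (λ j → vert H j ≟ w) | ∈-tabulate⁻ w∈
  ... | yes found | _ = found

  ∣N[v]∩H∣≤3 : (H : Hole G) {v : Fin n} (x y z : Fin n) →
               (∀ j → vert H j ≡ v ⊎ adj G v (vert H j) ≡ true → vert H j ≡ x ⊎ vert H j ≡ y ⊎ vert H j ≡ z) →
               ∣ closedNbhd G v ∩ holeSet H ∣ ≤ 3
  ∣N[v]∩H∣≤3 H {v} x y z located = p⊆⁅x,y,z⁆⇒∣p∣≤3 _ x y z members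
    where
    members : ∀ {w} → w ∈ closedNbhd G v ∩ holeSet H → w ≡ x ⊎ w ≡ y ⊎ w ≡ z
    members w∈ with x∈p∩q⁻ (closedNbhd G v) (holeSet H) w∈
    ... | w∈N , w∈H with ∈holeSet⁻ {H = H} w∈H
    ...   | j , refl = located j (∈closedNbhd⁻ w∈N)

corollary6p2 : ∀ {n} (G : Graph n) → Prereduced G →
    (H : Hole G) → ShortestHole G H →
    (v : Fin n) → ¬ (∀ i → adj G v (vert H i) ≡ true) →
    ∣ closedNbhd G v ∩ holeSet H ∣ ≤ 3
corollary6p2 G _ H shortest v not-all with any? (λ i → vert H i ≟ v)
... | yes (i , refl) = ∣N[v]∩H∣≤3 H (vert H i) (vert H (sucᶜ i)) (vert H (predᶜ i))
        λ j → [ inj₁ , inj₂ ∘ Sum.map (cong (vert H)) (cong (vert H)) ∘ hole-neighbours H i j ]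
... | no v∉H with any? (λ i → adj G v (vert H i) ≟ᵇ true)
...   | no isolated = ∣N[v]∩H∣≤3 H v v v
        λ j → [ (λ e → ⊥-elim (v∉H (j , e))) , (λ e → ⊥-elim (isolated (j , e))) ]
...   | yes adjacent with cyclic-descent (λ i → adj G v (vert H i)) adjacent not-all
...     | i , v~i , v≁i⁺ = ∣N[v]∩H∣≤3 H (vert H i) (vert H (predᶜ i)) (vert H (predᶜ (predᶜ i)))
        λ j → [ (λ e → ⊥-elim (v∉H (j , e))) ,
                Sum.map (cong (vert H)) (Sum.map (cong (vert H)) (cong (vert H)))
                ∘ neighbours-of-descent H shortest (λ j e → v∉H (j , e)) i v~i v≁i⁺ j ]
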